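{- There exists a family $\mathcal{F}\subseteq\mathcal{P}(2^{\omega})$ such that $\mathcal{F}=\mathcal{F}^{*}$.
   Context: $2^\omega$ is the Cantor space, an abelian group under coordinatewise addition modulo 2. For $A,B\subseteq 2^\omega$, $A+B=\{a+b:a\in A,b\in B\}$. For $\mathcal{F}\subseteq\mathcal{P}(2^\omega)$, $\mathcal{F}^{*}=\{A\subseteq 2^\omega:\ \forall F\in\mathcal{F}\ \ A+F\neq 2^\omega\}$. -}

module Defs where

open import Level using (Level; suc; zero)
open import Data.Nat using (ℕ)
open import Data.Bool using (Bool; _xor_)
open import Data.Product using (Σ; _×_; ∃)
open import Relation.Binary.PropositionalEquality using (_≡_)
open import Relation.Nullary using (¬_)

Cantor : Set
Cantor = ℕ → Bool

_⊕_ : Cantor → Cantor → Cantor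
(x ⊕ y) n = x n xor y n

Subset : Set₁
Subset = Cantor → Set

Family : Set₂
Family = Subset → Set₁

-- x ∈ A + B  (equality of points is pointwise)
InSum : Subset → Subset → Cantor → Set
InSum A B x = Σ Cantor λ a → Σ Cantor λ b → A a × B b × (∀ n → (a ⊕ b) n ≡ x n)

SumIsAll : Subset → Subset → Set
SumIsAll A B = ∀ x → InSum A B x

Star : Family → Family
Star 𝓕 A = ∀ F → 𝓕 F → ¬ SumIsAll A F

_≐_ : Family → Family → Set₁
𝓕 ≐ 𝓖 = ∀ A → (𝓕 A → 𝓖 A) × (𝓖 A → 𝓕 A)

{-# OPTIONS --safe #-}
module Submission where

-- Reading off coordinate k is a homomorphism from 2^ω onto ℤ/2; its kernel H and the
-- other coset are the sets {x : x k ≡ false} and {x : x k ≡ true}. Let 𝓕 be the family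
-- of sets lying inside a single coset. Two members of 𝓕 add up into a single coset, so
-- never to all of 2^ω: 𝓕 ⊆ 𝓕*. A set A meeting both cosets has A + H = 2^ω with H ∈ 𝓕:
-- 𝓕* ⊆ 𝓕.

open import Defs
open import Data.Bool using (Bool; true; false; _xor_; _≟_)
open import Data.Bool.Properties using (xor-same; not-involutive)
open import Data.Empty using (⊥-elim)
open import Data.Nat using (ℕ)
open import Data.Product using (Σ; _,_)
open import Data.Sum using (_⊎_; inj₁; inj₂)
open import Level using (Lift; lift)
open import Relation.Binary.PropositionalEquality
  using (_≡_; _≢_; refl; sym; trans; cong₂; subst)
open import Relation.Nullary using (¬_; yes; no)

xor-cancelˡ : ∀ x y → x xor (x xor y) ≡ y
xor-cancelˡ false y = refl
xor-cancelˡ true  y = not-involutive y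

≢⇒≡-either : ∀ {u v : Bool} → u ≢ v → ∀ w → w ≡ u ⊎ w ≡ v
≢⇒≡-either {false} {false} u≢v _     = ⊥-elim (u≢v refl)
≢⇒≡-either {false} {true}  _   false = inj₁ refl
≢⇒≡-either {false} {true}  _   true  = inj₂ refl
≢⇒≡-either {true}  {false} _   false = inj₂ refl
≢⇒≡-either {true}  {false} _   true  = inj₁ refl
≢⇒≡-either {true}  {true}  u≢v _     = ⊥-elim (u≢v refl)

ConstantAt : ℕ → Subset → Set
ConstantAt k A = ∀ {a b} → A a → A b → a k ≡ b k

constantAt : ℕ → Family
constantAt k A = Lift _ (ConstantAt k A)

Kernel : ℕ → Subset
Kernel k x = x k ≡ false

kernel∈constantAt : ∀ k → constantAt k (Kernel k)
kernel∈constantAt k = lift λ a≡false b≡false → trans a≡false (sym b≡false)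

constantAt-sum-notAll : ∀ k {A B} → ConstantAt k A → ConstantAt k B → ¬ SumIsAll A B
constantAt-sum-notAll k constA constB A+B=all
  with A+B=all (λ _ → false) | A+B=all (λ _ → true)
... | a₀ , b₀ , a₀∈A , b₀∈B , sum₀ | a₁ , b₁ , a₁∈A , b₁∈B , sum₁
  -- the all-false and the all-true point would get the same k-th bit
  with () ← trans (sym (sum₀ k))
              (trans (cong₂ _xor_ (constA a₀∈A a₁∈A) (constB b₀∈B b₁∈B)) (sum₁ k))

inSum-kernel : ∀ k {A c} x → A c → c k ≡ x k → InSum A (Kernel k) x
inSum-kernel k {c = c} x c∈A c≡x =
  c , (c ⊕ x) , c∈A , subst (λ b → b xor x k ≡ false) (sym c≡x) (xor-same (x k))
  , λ n → xor-cancelˡ (c n) (x n)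

sum-kernel-isAll : ∀ k {A a b} → A a → A b → a k ≢ b k → SumIsAll A (Kernel k)
sum-kernel-isAll k a∈A b∈A a≢b x with ≢⇒≡-either a≢b (x k)
... | inj₁ x≡a = inSum-kernel k x a∈A (sym x≡a)
... | inj₂ x≡b = inSum-kernel k x b∈A (sym x≡b)

constantAt-selfDual : ∀ k → constantAt k ≐ Star (constantAt k)
constantAt-selfDual k A = ⊆star , star⊆
  where
  ⊆star : constantAt k A → Star (constantAt k) A
  ⊆star (lift constA) B (lift constB) = constantAt-sum-notAll k constA constB

  star⊆ : Star (constantAt k) A → constantAt k A
  star⊆ A∈star = lift const
    where
    const : ConstantAt k A
    const {a} {b} a∈A b∈A with a k ≟ b k
    ... | yes a≡b = a≡b
    ... | no  a≢b = ⊥-elim (A∈star (Kernel k) (kernel∈constantAt k)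
                                   (sum-kernel-isAll k a∈A b∈A a≢b))

mainTheorem4 : Σ Family λ 𝓕 → 𝓕 ≐ Star 𝓕
mainTheorem4 = constantAt 0 , constantAt-selfDual 0
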